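{- Let $\mathbf A=(A,\wedge,\vee,\cdot,\backslash,\slash)$ be a unital residuated binar with multiplicative identity $e$ whose lattice reduct is complemented. If $\mathbf A$ is integral (i.e., $x\le e$ for all $x\in A$), then $x\cdot y = x\wedge y$ for all $x,y\in A$.
   Context: A residuated binar is an algebra $\mathbf A=(A,\wedge,\vee,\cdot,\backslash,\slash)$ where $(A,\wedge,\vee)$ is a lattice, $\cdot$ is a binary operation on $A$, and for all $x,y,z\in A$: $x\cdot y\le z \iff x\le z\slash y \iff y\le x\backslash z$. It is unital if $\cdot$ has an identity element $e$. Complemented means the lattice reduct is bounded (least element $\bot$, greatest $\top$) and every element $x$ has some $x'$ with $x\wedge x'=\bot$, $x\vee x'=\top$ (distributivity not assumed). -}

module Defs where

open import Level using (suc; _⊔_)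
open import Algebra.Core using (Op₂)
open import Data.Product using (_×_; ∃)
open import Function.Bundles using (_⇔_)
open import Relation.Binary.Lattice.Bundles using (BoundedLattice)

record UnitalBoundedResiduatedBinar c ℓ₁ ℓ₂ : Set (suc (c ⊔ ℓ₁ ⊔ ℓ₂)) where
  field
    boundedLattice : BoundedLattice c ℓ₁ ℓ₂
  open BoundedLattice boundedLattice public
  field
    _·_ : Op₂ Carrier
    _\\_ : Op₂ Carrier
    _//_ : Op₂ Carrier
    e : Carrier
    resid-left  : ∀ x y z → ((x · y) ≤ z) ⇔ (x ≤ (z // y))
    resid-right : ∀ x y z → ((x · y) ≤ z) ⇔ (y ≤ (x \\ z))
    identityˡ : ∀ x → (e · x) ≈ x
    identityʳ : ∀ x → (x · e) ≈ x

  Complemented : Set (c ⊔ ℓ₁)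
  Complemented = ∀ x → ∃ λ x' → ((x ∧ x') ≈ ⊥) × ((x ∨ x') ≈ ⊤)

  Integral : Set (c ⊔ ℓ₂)
  Integral = ∀ x → x ≤ e

-- In an integral residuated binar multiplication is monotone and bounded above by meet,
-- so x · y ≤ x ∧ y.  For the converse it suffices that every z is idempotent-below,
-- z ≤ z · z: then x ∧ y ≤ (x ∧ y) · (x ∧ y) ≤ x · y.  If z' is a complement of z then
-- z · z' ≤ z ∧ z' = ⊥, so both z and z' lie below z \ (z · z), hence so does
-- z ∨ z' = ⊤ ≥ e, and residuating gives z = z · e ≤ z · z.
module Submission where

open import Defs
open import Data.Product using (_,_)
open import Function.Bundles using (Equivalence)
import Relation.Binary.Reasoning.PartialOrder as PosetReasoning

module ResiduatedBinarProperties {c ℓ₁ ℓ₂} (A : UnitalBoundedResiduatedBinar c ℓ₁ ℓ₂) where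

  open UnitalBoundedResiduatedBinar A

  residuateʳ : ∀ {x y z} → (x · y) ≤ z → y ≤ (x \\ z)
  residuateʳ {x} {y} {z} = Equivalence.to (resid-right x y z)

  unresiduateʳ : ∀ {x y z} → y ≤ (x \\ z) → (x · y) ≤ z
  unresiduateʳ {x} {y} {z} = Equivalence.from (resid-right x y z)

  residuateˡ : ∀ {x y z} → (x · y) ≤ z → x ≤ (z // y)
  residuateˡ {x} {y} {z} = Equivalence.to (resid-left x y z)

  unresiduateˡ : ∀ {x y z} → x ≤ (z // y) → (x · y) ≤ z
  unresiduateˡ {x} {y} {z} = Equivalence.from (resid-left x y z)

  ·-monoʳ-≤ : ∀ x {y z} → y ≤ z → (x · y) ≤ (x · z)
  ·-monoʳ-≤ x y≤z = unresiduateʳ (trans y≤z (residuateʳ refl))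

  ·-monoˡ-≤ : ∀ x {y z} → y ≤ z → (y · x) ≤ (z · x)
  ·-monoˡ-≤ x y≤z = unresiduateˡ (trans y≤z (residuateˡ refl))

  ·-mono-≤ : ∀ {x y u v} → x ≤ y → u ≤ v → (x · u) ≤ (y · v)
  ·-mono-≤ {y = y} {u} x≤y u≤v = trans (·-monoˡ-≤ u x≤y) (·-monoʳ-≤ y u≤v)

  ·≤∧ : Integral → ∀ x y → (x · y) ≤ (x ∧ y)
  ·≤∧ integral x y = ∧-greatest
    (trans (·-monoʳ-≤ x (integral y)) (reflexive (identityʳ x)))
    (trans (·-monoˡ-≤ y (integral x)) (reflexive (identityˡ y)))

  ≤-square-of-annihilating-complement : ∀ {z z'} → (z ∨ z') ≈ ⊤ → (z · z') ≤ ⊥ →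
                                        z ≤ (z · z)
  ≤-square-of-annihilating-complement {z} {z'} z∨z'≈⊤ zz'≤⊥ = begin
    z      ≈⟨ Eq.sym (identityʳ z) ⟩
    z · e  ≤⟨ unresiduateʳ e≤z\zz ⟩
    z · z  ∎
    where
    open PosetReasoning poset
    e≤z\zz : e ≤ (z \\ (z · z))
    e≤z\zz = begin
      e                ≤⟨ maximum e ⟩
      ⊤                ≈⟨ Eq.sym z∨z'≈⊤ ⟩
      z ∨ z'          ≤⟨ ∨-least (residuateʳ refl) (residuateʳ (trans zz'≤⊥ (minimum (z · z)))) ⟩
      z \\ (z · z)    ∎

  ≤-square : Complemented → Integral → ∀ z → z ≤ (z · z)
  ≤-square complemented integral z with complemented z
  ... | z' , z∧z'≈⊥ , z∨z'≈⊤ =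
    ≤-square-of-annihilating-complement z∨z'≈⊤ (trans (·≤∧ integral z z') (reflexive z∧z'≈⊥))

lemma4p1 : ∀ {c ℓ₁ ℓ₂} (A : UnitalBoundedResiduatedBinar c ℓ₁ ℓ₂) →
    let open UnitalBoundedResiduatedBinar A in
    Complemented → Integral → ∀ x y → (x · y) ≈ (x ∧ y)
lemma4p1 A complemented integral x y = antisym (·≤∧ integral x y) (begin
  x ∧ y              ≤⟨ ≤-square complemented integral (x ∧ y) ⟩
  (x ∧ y) · (x ∧ y)  ≤⟨ ·-mono-≤ (x∧y≤x x y) (x∧y≤y x y) ⟩
  x · y              ∎)
  where
  open UnitalBoundedResiduatedBinar A
  open ResiduatedBinarProperties A
  open PosetReasoning poset
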